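{- Let $n$ and $T$ be integers with $n \equiv T \pmod 2$. Then there exist integers $a_0,a_1,a_2,a_3$ with $n=\sum_{\nu=0}^3 a_\nu^2$ and $\sum_{\nu=0}^3 a_\nu = T$ if and only if $4n-T^2$ is a sum of three squares of integers. -}

module Submission where

-- The proof rests on the 4×4 Hadamard transform
--   H(a,b,c,d) = (a+b+c+d, a+b−c−d, a−b+c−d, a−b−c+d),
-- which satisfies ‖H v‖² = 4‖v‖² and whose coordinates sum to 4a.
--
-- (⇒) If n = ‖a‖² and T = a₀+a₁+a₂+a₃, then H a = (T, x, y, z) and
--     T² + x² + y² + z² = 4n, so 4n − T² = x² + y² + z².
-- (⇐) Conversely, given 4n − T² = x² + y² + z², the vector H(T,x,y,z) has
--     norm 16n and coordinate sum 4T; if all its coordinates are divisible by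
--     4, the quarters a_ν solve the problem ('recover').  Divisibility by 4
--     is a condition on residues mod 4, and reducing the equation modulo 8
--     (using n ≡ T mod 2) constrains these residues so strongly that, after
--     possibly replacing x by −x, the condition always holds.  This last step
--     is a finite check over the 4⁴ residue patterns.

open import Data.Integer using (ℤ; _+_; _-_; _*_; +_; -_)
open import Data.Integer.Properties using (*-cancelˡ-≡; *-assoc)
open import Data.Integer.DivMod using (a≡a%ℕn+[a/ℕn]*n; n%ℕd<d; _/ℕ_; _%ℕ_)
open import Data.Integer.Divisibility using () renaming (_∣_ to _∣ᵤ_)
open import Data.Integer.Divisibility.Signed
  using (_∣_; _∣?_; divides; ∣ᵤ⇒∣; ∣-refl; ∣m∣n⇒∣m+n; ∣n⇒∣m*n)
open import Data.Integer.Tactic.RingSolver using (solve-∀)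
open import Data.Fin using (Fin; toℕ; fromℕ<)
open import Data.Fin.Properties using (toℕ-fromℕ<; all?)
open import Data.Product using (∃-syntax; _×_; _,_)
open import Data.Sum using (_⊎_; [_,_]′)
open import Function.Bundles using (_⇔_; mk⇔; Equivalence)
open import Relation.Nullary using (Dec)
open import Relation.Nullary.Decidable using (toWitness; _×-dec_; _⊎-dec_; _→-dec_)
open import Relation.Binary.PropositionalEquality
  using (_≡_; refl; sym; trans; cong; subst; module ≡-Reasoning)

open ≡-Reasoning

cong₄ : {A B C D E : Set} (f : A → B → C → D → E) {a a′ : A} {b b′ : B} {c c′ : C} {d d′ : D} →
        a ≡ a′ → b ≡ b′ → c ≡ c′ → d ≡ d′ → f a b c d ≡ f a′ b′ c′ d′
cong₄ f refl refl refl refl = refl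

h₀ h₁ h₂ h₃ : ℤ → ℤ → ℤ → ℤ → ℤ
h₀ a b c d = a + b + c + d
h₁ a b c d = a + b - c - d
h₂ a b c d = a - b + c - d
h₃ a b c d = a - b - c + d

norm4 : ℤ → ℤ → ℤ → ℤ → ℤ
norm4 a b c d = a * a + b * b + c * c + d * d

hadamard-norm : ∀ a b c d →
  norm4 (h₀ a b c d) (h₁ a b c d) (h₂ a b c d) (h₃ a b c d) ≡ + 4 * norm4 a b c d
hadamard-norm = expanded
  where
  expanded : ∀ a b c d →
    (a + b + c + d) * (a + b + c + d) + (a + b - c - d) * (a + b - c - d)
      + (a - b + c - d) * (a - b + c - d) + (a - b - c + d) * (a - b - c + d)
    ≡ + 4 * (a * a + b * b + c * c + d * d)
  expanded = solve-∀

hadamard-sum : ∀ a b c d → h₀ a b c d + h₁ a b c d + h₂ a b c d + h₃ a b c d ≡ + 4 * a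
hadamard-sum = expanded
  where
  expanded : ∀ a b c d →
    (a + b + c + d) + (a + b - c - d) + (a - b + c - d) + (a - b - c + d) ≡ + 4 * a
  expanded = solve-∀

norm4-scale : ∀ k a b c d → norm4 (a * k) (b * k) (c * k) (d * k) ≡ (k * k) * norm4 a b c d
norm4-scale = expanded
  where
  expanded : ∀ k a b c d → (a * k) * (a * k) + (b * k) * (b * k) + (c * k) * (c * k) + (d * k) * (d * k)
                         ≡ (k * k) * (a * a + b * b + c * c + d * d)
  expanded = solve-∀

first-square⇔ : ∀ m t x y z → (norm4 t x y z ≡ m) ⇔ (m - t * t ≡ x * x + y * y + z * z)
first-square⇔ m t x y z = mk⇔ isolate restore
  where
  isolate : norm4 t x y z ≡ m → m - t * t ≡ x * x + y * y + z * z
  isolate refl = cancel t x y z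
    where
    cancel : ∀ t x y z → t * t + x * x + y * y + z * z - t * t ≡ x * x + y * y + z * z
    cancel = solve-∀

  restore : m - t * t ≡ x * x + y * y + z * z → norm4 t x y z ≡ m
  restore E = begin
    norm4 t x y z                    ≡⟨ regroup t x y z ⟩
    t * t + (x * x + y * y + z * z)  ≡⟨ cong (λ s → t * t + s) E ⟨
    t * t + (m - t * t)              ≡⟨ add-sub t m ⟩
    m                                ∎
    where
    regroup : ∀ t x y z → t * t + x * x + y * y + z * z ≡ t * t + (x * x + y * y + z * z)
    regroup = solve-∀
    add-sub : ∀ t m → t * t + (m - t * t) ≡ m
    add-sub = solve-∀

FourSquaresWithSum : ℤ → ℤ → Set
FourSquaresWithSum n T = ∃[ a₀ ] ∃[ a₁ ] ∃[ a₂ ] ∃[ a₃ ]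
  ((n ≡ a₀ * a₀ + a₁ * a₁ + a₂ * a₂ + a₃ * a₃) × (a₀ + a₁ + a₂ + a₃ ≡ T))

ThreeSquares : ℤ → Set
ThreeSquares m = ∃[ x ] ∃[ y ] ∃[ z ] (m ≡ x * x + y * y + z * z)

forward : ∀ n T → FourSquaresWithSum n T → ThreeSquares (+ 4 * n - T * T)
forward _ _ (a₀ , a₁ , a₂ , a₃ , refl , refl) =
  h₁ a₀ a₁ a₂ a₃ , h₂ a₀ a₁ a₂ a₃ , h₃ a₀ a₁ a₂ a₃ ,
  Equivalence.to (first-square⇔ (+ 4 * norm4 a₀ a₁ a₂ a₃) (h₀ a₀ a₁ a₂ a₃)
                                  (h₁ a₀ a₁ a₂ a₃) (h₂ a₀ a₁ a₂ a₃) (h₃ a₀ a₁ a₂ a₃))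
                 (hadamard-norm a₀ a₁ a₂ a₃)

Liftable : ℤ → ℤ → ℤ → ℤ → Set
Liftable t x y z =
  (+ 4 ∣ h₀ t x y z) × (+ 4 ∣ h₁ t x y z) × (+ 4 ∣ h₂ t x y z) × (+ 4 ∣ h₃ t x y z)

liftable? : ∀ t x y z → Dec (Liftable t x y z)
liftable? t x y z =
  (+ 4 ∣? h₀ t x y z) ×-dec (+ 4 ∣? h₁ t x y z) ×-dec (+ 4 ∣? h₂ t x y z) ×-dec (+ 4 ∣? h₃ t x y z)

-- (⇐) for liftable solutions: the quarters of H(T,x,y,z) are the a_ν, since
-- their sum is ¼·4T and their squared norm is (1/16)·4·4n.
recover : ∀ {n T x y z} → Liftable T x y z → + 4 * n - T * T ≡ x * x + y * y + z * z →
          FourSquaresWithSum n T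
recover {n} {T} {x} {y} {z} (divides a₀ e₀ , divides a₁ e₁ , divides a₂ e₂ , divides a₃ e₃) E =
  a₀ , a₁ , a₂ , a₃ ,
  *-cancelˡ-≡ (+ 16) n (norm4 a₀ a₁ a₂ a₃) norms ,
  *-cancelˡ-≡ (+ 4) (a₀ + a₁ + a₂ + a₃) T sums
  where
  sum4 : ℤ → ℤ → ℤ → ℤ → ℤ
  sum4 a b c d = a + b + c + d

  scale-sum : ∀ k a b c d → k * (a + b + c + d) ≡ a * k + b * k + c * k + d * k
  scale-sum = solve-∀

  sums : + 4 * (a₀ + a₁ + a₂ + a₃) ≡ + 4 * T
  sums = begin
    + 4 * (a₀ + a₁ + a₂ + a₃)                          ≡⟨ scale-sum (+ 4) a₀ a₁ a₂ a₃ ⟩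
    a₀ * + 4 + a₁ * + 4 + a₂ * + 4 + a₃ * + 4           ≡⟨ cong₄ sum4 e₀ e₁ e₂ e₃ ⟨
    h₀ T x y z + h₁ T x y z + h₂ T x y z + h₃ T x y z  ≡⟨ hadamard-sum T x y z ⟩
    + 4 * T                                            ∎

  norms : + 16 * n ≡ + 16 * norm4 a₀ a₁ a₂ a₃
  norms = begin
    + 16 * n                                          ≡⟨ *-assoc (+ 4) (+ 4) n ⟩
    + 4 * (+ 4 * n)                                   ≡⟨ cong (+ 4 *_) normT ⟨
    + 4 * norm4 T x y z                               ≡⟨ hadamard-norm T x y z ⟨
    norm4 (h₀ T x y z) (h₁ T x y z) (h₂ T x y z) (h₃ T x y z)
                                                      ≡⟨ cong₄ norm4 e₀ e₁ e₂ e₃ ⟩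
    norm4 (a₀ * + 4) (a₁ * + 4) (a₂ * + 4) (a₃ * + 4)  ≡⟨ norm4-scale (+ 4) a₀ a₁ a₂ a₃ ⟩
    + 16 * norm4 a₀ a₁ a₂ a₃                          ∎
    where
    normT : norm4 T x y z ≡ + 4 * n
    normT = Equivalence.from (first-square⇔ (+ 4 * n) T x y z) E

infix 4 _≡_mod_
record _≡_mod_ (a b m : ℤ) : Set where
  constructor congruent
  field
    quotient : ℤ
    equation : a ≡ b + quotient * m

∣⇒≡mod : ∀ {m a b} → m ∣ a - b → a ≡ b mod m
∣⇒≡mod {m} {a} {b} (divides q e) = congruent q (begin
  a             ≡⟨ add-sub b a ⟨
  b + (a - b)   ≡⟨ cong (λ s → b + s) e ⟩
  b + q * m     ∎)
  where
  add-sub : ∀ b a → b + (a - b) ≡ a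
  add-sub = solve-∀

≡mod⇒∣ : ∀ {m a b} → a ≡ b mod m → m ∣ a - b
≡mod⇒∣ {m} {b = b} (congruent q refl) = divides q (sub-add b q m)
  where
  sub-add : ∀ b q m → b + q * m - b ≡ q * m
  sub-add = solve-∀

∣-resp-≡mod : ∀ {m a b} → a ≡ b mod m → m ∣ b → m ∣ a
∣-resp-≡mod (congruent q refl) m∣b = ∣m∣n⇒∣m+n m∣b (∣n⇒∣m*n q ∣-refl)

mod-sym : ∀ {m a b} → a ≡ b mod m → b ≡ a mod m
mod-sym {m} {b = b} (congruent q refl) = congruent (- q) (back b q m)
  where
  back : ∀ b q m → b ≡ b + q * m + - q * m
  back = solve-∀

mod-trans : ∀ {m a b c} → a ≡ b mod m → b ≡ c mod m → a ≡ c mod m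
mod-trans {m} {c = c} (congruent q refl) (congruent p refl) = congruent (p + q) (regroup c p q m)
  where
  regroup : ∀ c p q m → c + p * m + q * m ≡ c + (p + q) * m
  regroup = solve-∀

mod-+ : ∀ {m a b c d} → a ≡ b mod m → c ≡ d mod m → a + c ≡ b + d mod m
mod-+ {m} {b = b} {d = d} (congruent q refl) (congruent p refl) = congruent (q + p) (regroup b d q p m)
  where
  regroup : ∀ b d q p m → b + q * m + (d + p * m) ≡ b + d + (q + p) * m
  regroup = solve-∀

mod-neg : ∀ {m a b} → a ≡ b mod m → - a ≡ - b mod m
mod-neg {m} {b = b} (congruent q refl) = congruent (- q) (negate b q m)
  where
  negate : ∀ b q m → - (b + q * m) ≡ - b + - q * m
  negate = solve-∀

mod-- : ∀ {m a b c d} → a ≡ b mod m → c ≡ d mod m → a - c ≡ b - d mod m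
mod-- a≡b c≡d = mod-+ a≡b (mod-neg c≡d)

mod-scale : ∀ k {m a b} → a ≡ b mod m → k * a ≡ k * b mod k * m
mod-scale k {m} {b = b} (congruent q refl) = congruent q (distribute k b q m)
  where
  distribute : ∀ k b q m → k * (b + q * m) ≡ k * b + q * (k * m)
  distribute = solve-∀

mod-weaken : ∀ k {m a b} → a ≡ b mod k * m → a ≡ b mod m
mod-weaken k {m} {b = b} (congruent q refl) = congruent (q * k) (regroup k b q m)
  where
  regroup : ∀ k b q m → b + q * (k * m) ≡ b + q * k * m
  regroup = solve-∀

mod-square : ∀ {m a b} → a ≡ b mod + 2 * m → a * a ≡ b * b mod + 4 * m
mod-square {m} {b = b} (congruent q refl) = congruent (b * q + q * q * m) (expand b q m)
  where
  expand : ∀ b q m → (b + q * (+ 2 * m)) * (b + q * (+ 2 * m)) ≡ b * b + (b * q + q * q * m) * (+ 4 * m)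
  expand = solve-∀

⟦_⟧ : Fin 4 → ℤ
⟦ r ⟧ = + toℕ r

residue : ∀ x → ∃[ r ] (x ≡ ⟦ r ⟧ mod + 4)
residue x = fromℕ< (n%ℕd<d x 4) , congruent (x /ℕ 4) (begin
  x                                       ≡⟨ a≡a%ℕn+[a/ℕn]*n x 4 ⟩
  + (x %ℕ 4) + x /ℕ 4 * + 4               ≡⟨ cong (λ r → + r + x /ℕ 4 * + 4) (toℕ-fromℕ< _) ⟨
  ⟦ fromℕ< (n%ℕd<d x 4) ⟧ + x /ℕ 4 * + 4  ∎)

liftable-resp : ∀ {t x y z t′ x′ y′ z′} →
  t ≡ t′ mod + 4 → x ≡ x′ mod + 4 → y ≡ y′ mod + 4 → z ≡ z′ mod + 4 →
  Liftable t′ x′ y′ z′ → Liftable t x y z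
liftable-resp t≡ x≡ y≡ z≡ (d₀ , d₁ , d₂ , d₃) =
  ∣-resp-≡mod (mod-+ (mod-+ (mod-+ t≡ x≡) y≡) z≡) d₀ ,
  ∣-resp-≡mod (mod-- (mod-- (mod-+ t≡ x≡) y≡) z≡) d₁ ,
  ∣-resp-≡mod (mod-- (mod-+ (mod-- t≡ x≡) y≡) z≡) d₂ ,
  ∣-resp-≡mod (mod-+ (mod-- (mod-- t≡ x≡) y≡) z≡) d₃

-- The shadow mod 8 of the equation 4n − t² = x² + y² + z² when n ≡ t (mod 2).
Balanced : ℤ → ℤ → ℤ → ℤ → Set
Balanced t x y z = + 8 ∣ (+ 4 * t - t * t) - (x * x + y * y + z * z)

balanced? : ∀ t x y z → Dec (Balanced t x y z)
balanced? t x y z = + 8 ∣? (+ 4 * t - t * t) - (x * x + y * y + z * z)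

-- The residues mod 4 of a solution are balanced: 4n ≡ 4t and squares are
-- determined mod 8 by residues mod 4.
balanced-residues : ∀ {n T x y z t x′ y′ z′} → n ≡ T mod + 2 →
  T ≡ t mod + 4 → x ≡ x′ mod + 4 → y ≡ y′ mod + 4 → z ≡ z′ mod + 4 →
  + 4 * n - T * T ≡ x * x + y * y + z * z → Balanced t x′ y′ z′
balanced-residues {n} {T} {x} {y} {z} {t} {x′} {y′} {z′} n≡T T≡t x≡ y≡ z≡ E =
  ≡mod⇒∣ (mod-trans (mod-sym left) (subst (λ s → s ≡ _ mod + 8) (sym E) right))
  where
  left : + 4 * n - T * T ≡ + 4 * t - t * t mod + 8
  left = mod-- (mod-scale (+ 4) (mod-trans n≡T (mod-weaken (+ 2) {m = + 2} T≡t)))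
               (mod-square {m = + 2} T≡t)

  right : x * x + y * y + z * z ≡ x′ * x′ + y′ * y′ + z′ * z′ mod + 8
  right = mod-+ (mod-+ (mod-square {m = + 2} x≡) (mod-square {m = + 2} y≡)) (mod-square {m = + 2} z≡)

balanced⇒liftable : ∀ (t x y z : Fin 4) → Balanced ⟦ t ⟧ ⟦ x ⟧ ⟦ y ⟧ ⟦ z ⟧ →
  Liftable ⟦ t ⟧ ⟦ x ⟧ ⟦ y ⟧ ⟦ z ⟧ ⊎ Liftable ⟦ t ⟧ (- ⟦ x ⟧) ⟦ y ⟧ ⟦ z ⟧
balanced⇒liftable = toWitness {a? = all? λ t → all? λ x → all? λ y → all? λ z →
  balanced? ⟦ t ⟧ ⟦ x ⟧ ⟦ y ⟧ ⟦ z ⟧ →-dec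
  (liftable? ⟦ t ⟧ ⟦ x ⟧ ⟦ y ⟧ ⟦ z ⟧ ⊎-dec liftable? ⟦ t ⟧ (- ⟦ x ⟧) ⟦ y ⟧ ⟦ z ⟧)} _

flip-sign : ∀ {m} x y z → m ≡ x * x + y * y + z * z → m ≡ - x * - x + y * y + z * z
flip-sign x y z E = trans E (cong (λ w → w + y * y + z * z) (neg-square x))
  where
  neg-square : ∀ x → x * x ≡ - x * - x
  neg-square = solve-∀

backward : ∀ n T → + 2 ∣ᵤ n - T → ThreeSquares (+ 4 * n - T * T) → FourSquaresWithSum n T
backward n T 2∣n-T (x , y , z , E)
  with t , T≡t ← residue T | r , x≡r ← residue x | s , y≡s ← residue y | u , z≡u ← residue z =
  [ (λ L → recover {n} (liftable-resp T≡t x≡r y≡s z≡u L) E)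
  , (λ L → recover {n} (liftable-resp T≡t (mod-neg x≡r) y≡s z≡u L) (flip-sign x y z E))
  ]′ (balanced⇒liftable t r s u (balanced-residues {n} (∣⇒≡mod (∣ᵤ⇒∣ 2∣n-T)) T≡t x≡r y≡s z≡u E))

mainTheorem1 : (n T : ℤ) → (+ 2) ∣ᵤ (n - T) →
    ((∃[ a₀ ] ∃[ a₁ ] ∃[ a₂ ] ∃[ a₃ ]
        ((n ≡ a₀ * a₀ + a₁ * a₁ + a₂ * a₂ + a₃ * a₃) × (a₀ + a₁ + a₂ + a₃ ≡ T)))
     ⇔
     (∃[ x ] ∃[ y ] ∃[ z ] (+ 4 * n - T * T ≡ x * x + y * y + z * z)))
mainTheorem1 n T 2∣n-T = mk⇔ (forward n T) (backward n T 2∣n-T)
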